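{- Fix an integer $s\ge0$. As formal power series, $$\sum_{k=1}^{\infty} d_s(k)z^k \;=\; z+\frac{z^2}{1-z^2}\sum_{i=1}^{\infty} z^{si+2^i-1}\bigl(1-z^{2^i}\bigr).$$
   Context: Fix an integer $s\ge 0$. Let $\mathcal{T}_s$ be the following infinite graph. It has super-nodes (level 0 nodes) $s_1,s_2,s_3,\dots$, with $s_{i+1}$ adjacent to $s_i$ for each $i\ge1$. Each super-node $s_i$ has $2^{i-1}$ children (level 1 nodes), called in left-to-right order the 1st, 2nd, $\dots$, $2^{i-1}$th child of $s_i$. Each level 1 node has exactly one child, a level 2 node, and level 2 nodes have no children. In addition there is one isolated node $I$. The leaves of $\mathcal{T}_s$ are the level 2 nodes together with $I$. Nodes are labelled by positive integers as follows: $I$ gets label $1$; then for $i=1,2,3,\dots$ in turn, the super-node $s_i$ receives the next $s$ consecutive unused labels (no label at all if $s=0$), and then for $r=1,2,\dots,2^{i-1}$ in turn, the $r$th child of $s_i$ receives the next unused label and then its child (a leaf) receives the next unused label. Thus each positive integer labels exactly one node. For $n\ge1$ let $v_s(n)$ be the node with label $n$, and let $d_s(n)=1$ if $v_s(n)$ is a leaf and $d_s(n)=0$ otherwise. -}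

module Defs where

open import Data.Nat as ℕ using (ℕ; zero; suc; _∸_; _^_; _<ᵇ_)
open import Data.Nat.DivMod using (_%_)
open import Data.Bool using (Bool; true; false; if_then_else_)
open import Data.Integer as ℤ using (ℤ; +_)

-- Nodes of T_s.  Indices: super i j = s_i (i ≥ 1), carrying its (j+1)-th
-- label (j < s); child i r = the r-th child of s_i (1 ≤ r ≤ 2^(i-1));
-- leaf i r = the child of that node (a level 2 node).
data Node : Set where
  isolated : Node
  super    : ℕ → ℕ → Node
  child    : ℕ → ℕ → Node
  leaf     : ℕ → ℕ → Node

-- Block i (i = 1,2,…) consists of the
-- s labels of s_i followed by, for r = 1..2^(i-1), the label of the r-th
-- child and then the label of its leaf child; block size s + 2^i.
-- 'locate s fuel i m' returns the node whose label has offset m (0-based)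
-- from the start of block i.  Each block has size ≥ 2, so fuel = m suffices.
locate : ℕ → ℕ → ℕ → ℕ → Node
locate s fuel i m with m <ᵇ s
... | true  = super i m
... | false with (m ∸ s) <ᵇ (2 ^ i)
...   | true  = if ((m ∸ s) % 2) ℕ.≡ᵇ 0
                  then child i (suc ((m ∸ s) Data.Nat.DivMod./ 2))
                  else leaf  i (suc ((m ∸ s) Data.Nat.DivMod./ 2))
...   | false with fuel
...     | zero     = isolated   -- unreachable when fuel = m initially
...     | suc fuel' = locate s fuel' (suc i) (m ∸ (s ℕ.+ 2 ^ i))

-- v_s(n): the node with label n (n ≥ 1).  Label 1 is I; labels 2,3,… are
-- distributed over the blocks i = 1,2,….  (v_s 0 is a dummy value.)
v : ℕ → ℕ → Node
v s zero          = isolated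
v s (suc zero)    = isolated
v s (suc (suc m)) = locate s m 1 m

isLeaf : Node → Bool
isLeaf isolated    = true
isLeaf (super _ _) = false
isLeaf (child _ _) = false
isLeaf (leaf _ _)  = true

d : ℕ → ℕ → ℤ
d s n = if isLeaf (v s n) then + 1 else + 0

Series : Set
Series = ℕ → ℤ

sumBelow : (ℕ → ℤ) → ℕ → ℤ
sumBelow f zero    = + 0
sumBelow f (suc n) = sumBelow f n ℤ.+ f n

_+ₛ_ : Series → Series → Series
(f +ₛ g) n = f n ℤ.+ g n

_-ₛ_ : Series → Series → Series
(f -ₛ g) n = f n ℤ.- g n

_*ₛ_ : Series → Series → Series
(f *ₛ g) n = sumBelow (λ j → f j ℤ.* g (n ∸ j)) (suc n)

zpow : ℕ → Series
zpow k n = if k ℕ.≡ᵇ n then + 1 else + 0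

inv1-z² : Series
inv1-z² n = if (n % 2) ℕ.≡ᵇ 0 then + 1 else + 0

sumSeries : (ℕ → Series) → ℕ → Series
sumSeries F zero    n = + 0
sumSeries F (suc N) n = sumSeries F N n ℤ.+ F (suc N) n

lhs : ℕ → Series
lhs s zero    = + 0
lhs s (suc k) = d s (suc k)

term : ℕ → ℕ → Series
term s i = zpow (s ℕ.* i ℕ.+ 2 ^ i ∸ 1) *ₛ (zpow 0 -ₛ zpow (2 ^ i))

rhsUpTo : ℕ → ℕ → Series
rhsUpTo s N = zpow 1 +ₛ ((zpow 2 *ₛ inv1-z²) *ₛ sumSeries (term s) N)

module Submission where

-- Labels 2,3,... are cut into blocks: block k (k = 0,1,...) belongs to the
-- super-node s_(k+1), starts at label  blockStart s k = s·k + 2^(k+1)  and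
-- consists of s super-node labels followed by 2^(k+1) labels alternating
-- child, leaf.  So the leaves of block k are the labels  childStart + y
-- with  childStart = blockStart s k + s  and  y < 2^(k+1)  odd.
--
-- On the series side, z^a (1 - z^b) · z^2/(1-z^2) is z^(a+2) times the
-- truncated geometric series (1 - z^b)/(1 - z^2) = 1 + z^2 + ... + z^(b-2)
-- for even b.  For the (k+1)-th summand, a + 2 = childStart + 1 and
-- b = 2^(k+1), so its coefficient at label n is exactly the indicator of
-- "n is a leaf of block k" (and vanishes outside block k).

open import Defs
open import Data.Nat using (ℕ; _≤_)
open import Relation.Binary.PropositionalEquality using (_≡_)
open import Data.Nat using (zero; suc; _+_; _*_; _∸_; _^_; _<ᵇ_; _≡ᵇ_; _<_; _≤′_; ≤′-refl; ≤′-step; z≤n; s≤s; s≤s⁻¹)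
open import Data.Nat.Properties
open import Data.Nat.DivMod using (_%_; [m+kn]%n≡m%n)
import Data.Nat.Tactic.RingSolver as ℕ-Solver
open import Data.Integer as ℤ using (ℤ; +_)
import Data.Integer.Properties as ℤₚ
import Data.Integer.Tactic.RingSolver as ℤ-Solver
open import Data.Bool using (Bool; true; false; if_then_else_; not)
open import Data.Bool.Properties using (not-involutive)
open import Data.Empty using (⊥-elim)
open import Data.Sum using (inj₁; inj₂)
open import Relation.Binary.Definitions using (tri<; tri≈; tri>)
open import Relation.Nullary.Reflects using (ofʸ; ofⁿ)
open import Relation.Binary.PropositionalEquality
  using (_≢_; refl; sym; trans; cong; cong₂; subst; module ≡-Reasoning)

sumBelow-cong : ∀ {f g : ℕ → ℤ} M → (∀ j → j < M → f j ≡ g j) →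
                sumBelow f M ≡ sumBelow g M
sumBelow-cong zero    eq = refl
sumBelow-cong (suc M) eq =
  cong₂ ℤ._+_ (sumBelow-cong M (λ j j<M → eq j (m<n⇒m<1+n j<M))) (eq M ≤-refl)

sumBelow-zero : ∀ {g : ℕ → ℤ} M → (∀ j → j < M → g j ≡ + 0) → sumBelow g M ≡ + 0
sumBelow-zero zero    g≡0 = refl
sumBelow-zero (suc M) g≡0
  rewrite sumBelow-zero M (λ j j<M → g≡0 j (m<n⇒m<1+n j<M)) | g≡0 M ≤-refl = refl

sumBelow-single : ∀ {g : ℕ → ℤ} M k → k < M → (∀ j → j < M → j ≢ k → g j ≡ + 0) →
                  sumBelow g M ≡ g k
sumBelow-single {g} (suc M) k k<1+M g≡0 with m≤n⇒m<n∨m≡n (s≤s⁻¹ k<1+M)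
... | inj₁ k<M
  rewrite sumBelow-single M k k<M (λ j j<M → g≡0 j (m<n⇒m<1+n j<M))
        | g≡0 M ≤-refl (λ M≡k → <-irrefl (sym M≡k) k<M) = ℤₚ.+-identityʳ (g k)
... | inj₂ refl
  rewrite sumBelow-zero M (λ j j<M → g≡0 j (m<n⇒m<1+n j<M) (λ j≡M → <-irrefl j≡M j<M))
  = ℤₚ.+-identityˡ (g M)

sumBelow-+ : ∀ {f g : ℕ → ℤ} M →
             sumBelow (λ j → f j ℤ.+ g j) M ≡ sumBelow f M ℤ.+ sumBelow g M
sumBelow-+ zero = refl
sumBelow-+ {f} {g} (suc M) rewrite sumBelow-+ {f} {g} M =
  interchange (sumBelow f M) (sumBelow g M) (f M) (g M)
  where
  interchange : ∀ a b c d → a ℤ.+ b ℤ.+ (c ℤ.+ d) ≡ a ℤ.+ c ℤ.+ (b ℤ.+ d)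
  interchange = ℤ-Solver.solve-∀

sumBelow-- : ∀ {f g : ℕ → ℤ} M →
             sumBelow (λ j → f j ℤ.- g j) M ≡ sumBelow f M ℤ.- sumBelow g M
sumBelow-- zero = refl
sumBelow-- {f} {g} (suc M) rewrite sumBelow-- {f} {g} M =
  interchange (sumBelow f M) (sumBelow g M) (f M) (g M)
  where
  interchange : ∀ a b c d → a ℤ.- b ℤ.+ (c ℤ.- d) ≡ a ℤ.+ c ℤ.- (b ℤ.+ d)
  interchange = ℤ-Solver.solve-∀

sumSeries-zero : ∀ F N n → (∀ k → suc k ≤ N → F (suc k) n ≡ + 0) → sumSeries F N n ≡ + 0
sumSeries-zero F zero    n F≡0 = refl
sumSeries-zero F (suc N) n F≡0
  rewrite sumSeries-zero F N n (λ k k<N → F≡0 k (m≤n⇒m≤1+n k<N)) | F≡0 N ≤-refl = refl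

sumSeries-single : ∀ F N n t → suc t ≤ N →
                   (∀ k → suc k ≤ N → k ≢ t → F (suc k) n ≡ + 0) →
                   sumSeries F N n ≡ F (suc t) n
sumSeries-single F (suc N) n t t<1+N F≡0 with m≤n⇒m<n∨m≡n t<1+N
... | inj₁ t<N
  rewrite sumSeries-single F N n t (s≤s⁻¹ t<N) (λ k k<N → F≡0 k (m≤n⇒m≤1+n k<N))
        | F≡0 N ≤-refl (λ N≡t → <-irrefl (cong suc (sym N≡t)) t<N)
  = ℤₚ.+-identityʳ (F (suc t) n)
... | inj₂ refl
  rewrite sumSeries-zero F t n (λ k k<t → F≡0 k (m≤n⇒m≤1+n k<t) (λ k≡t → <-irrefl k≡t k<t))
  = ℤₚ.+-identityˡ (F (suc t) n)

*ₛ-congʳ : ∀ f {g h} → (∀ m → g m ≡ h m) → ∀ n → (f *ₛ g) n ≡ (f *ₛ h) n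
*ₛ-congʳ f g≡h n = sumBelow-cong (suc n) (λ j _ → cong (f j ℤ.*_) (g≡h (n ∸ j)))

*ₛ-distribˡ-+ : ∀ f g h n → (f *ₛ (g +ₛ h)) n ≡ (f *ₛ g) n ℤ.+ (f *ₛ h) n
*ₛ-distribˡ-+ f g h n =
  trans (sumBelow-cong (suc n) (λ j _ → ℤₚ.*-distribˡ-+ (f j) (g (n ∸ j)) (h (n ∸ j))))
        (sumBelow-+ (suc n))

*ₛ-distribˡ-- : ∀ f g h n → (f *ₛ (g -ₛ h)) n ≡ (f *ₛ g) n ℤ.- (f *ₛ h) n
*ₛ-distribˡ-- f g h n =
  trans (sumBelow-cong (suc n) (λ j _ → distrib (f j) (g (n ∸ j)) (h (n ∸ j))))
        (sumBelow-- (suc n))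
  where
  distrib : ∀ a b c → a ℤ.* (b ℤ.- c) ≡ a ℤ.* b ℤ.- a ℤ.* c
  distrib = ℤ-Solver.solve-∀

*ₛ-distribˡ-sumSeries : ∀ f F N n →
                        (f *ₛ sumSeries F N) n ≡ sumSeries (λ i → f *ₛ F i) N n
*ₛ-distribˡ-sumSeries f F zero    n = sumBelow-zero (suc n) (λ j _ → ℤₚ.*-zeroʳ (f j))
*ₛ-distribˡ-sumSeries f F (suc N) n =
  trans (*ₛ-distribˡ-+ f (sumSeries F N) (F (suc N)) n)
        (cong (ℤ._+ (f *ₛ F (suc N)) n) (*ₛ-distribˡ-sumSeries f F N n))

shift : ℕ → Series → Series
shift zero    f n       = f n
shift (suc c) f zero    = + 0
shift (suc c) f (suc n) = shift c f n

shift-below : ∀ c f {n} → n < c → shift c f n ≡ + 0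
shift-below (suc c) f {zero}  _         = refl
shift-below (suc c) f {suc n} (s≤s n<c) = shift-below c f n<c

shift-+ : ∀ c f x → shift c f (c + x) ≡ f x
shift-+ zero    f x = refl
shift-+ (suc c) f x = shift-+ c f x

shift-∸ : ∀ c f {n} → c ≤ n → shift c f n ≡ f (n ∸ c)
shift-∸ c f {n} c≤n = trans (cong (shift c f) (sym (m+[n∸m]≡n c≤n))) (shift-+ c f (n ∸ c))

shift-cong : ∀ c {f g} → (∀ m → f m ≡ g m) → ∀ n → shift c f n ≡ shift c g n
shift-cong zero    f≡g n       = f≡g n
shift-cong (suc c) f≡g zero    = refl
shift-cong (suc c) f≡g (suc n) = shift-cong c f≡g n

shift-shift : ∀ c d f n → shift c (shift d f) n ≡ shift (c + d) f n
shift-shift zero    d f n       = refl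
shift-shift (suc c) d f zero    = refl
shift-shift (suc c) d f (suc n) = shift-shift c d f n

shift-- : ∀ c f g n → shift c (f -ₛ g) n ≡ shift c f n ℤ.- shift c g n
shift-- zero    f g n       = refl
shift-- (suc c) f g zero    = refl
shift-- (suc c) f g (suc n) = shift-- c f g n

zpow-shift : ∀ c n → zpow c n ≡ shift c (zpow 0) n
zpow-shift zero    n       = refl
zpow-shift (suc c) zero    = refl
zpow-shift (suc c) (suc n) = zpow-shift c n

zpow-diag : ∀ c → zpow c c ≡ + 1
zpow-diag zero    = refl
zpow-diag (suc c) = zpow-diag c

zpow-offdiag : ∀ c m → c ≢ m → zpow c m ≡ + 0
zpow-offdiag c m c≢m = trans (zpow-shift c m) (offdiag c m c≢m)
  where
  offdiag : ∀ c m → c ≢ m → shift c (zpow 0) m ≡ + 0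
  offdiag zero    zero    0≢0 = ⊥-elim (0≢0 refl)
  offdiag zero    (suc m) _   = refl
  offdiag (suc c) zero    _   = refl
  offdiag (suc c) (suc m) c≢m = offdiag c m (λ c≡m → c≢m (cong suc c≡m))

zpow-*ₛ : ∀ c f n → (zpow c *ₛ f) n ≡ shift c f n
zpow-*ₛ c f n with ≤-<-connex c n
... | inj₁ c≤n = begin
    (zpow c *ₛ f) n         ≡⟨ sumBelow-single (suc n) c (s≤s c≤n) (λ j _ j≢c → vanish j j≢c) ⟩
    zpow c c ℤ.* f (n ∸ c)  ≡⟨ cong (ℤ._* f (n ∸ c)) (zpow-diag c) ⟩
    + 1 ℤ.* f (n ∸ c)       ≡⟨ ℤₚ.*-identityˡ (f (n ∸ c)) ⟩
    f (n ∸ c)               ≡⟨ sym (shift-∸ c f c≤n) ⟩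
    shift c f n             ∎
  where
  open ≡-Reasoning
  vanish : ∀ j → j ≢ c → zpow c j ℤ.* f (n ∸ j) ≡ + 0
  vanish j j≢c = trans (cong (ℤ._* f (n ∸ j)) (zpow-offdiag c j (λ c≡j → j≢c (sym c≡j))))
                       (ℤₚ.*-zeroˡ (f (n ∸ j)))
... | inj₂ n<c = trans (sumBelow-zero (suc n) vanish) (sym (shift-below c f n<c))
  where
  vanish : ∀ j → j < suc n → zpow c j ℤ.* f (n ∸ j) ≡ + 0
  vanish j j≤n = trans (cong (ℤ._* f (n ∸ j))
                               (zpow-offdiag c j (λ c≡j → <-irrefl (sym c≡j) (<-≤-trans j≤n n<c))))
                       (ℤₚ.*-zeroˡ (f (n ∸ j)))

*ₛ-zpow : ∀ f c n → (f *ₛ zpow c) n ≡ shift c f n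
*ₛ-zpow f c n with ≤-<-connex c n
... | inj₁ c≤n = begin
    (f *ₛ zpow c) n                       ≡⟨ sumBelow-single (suc n) (n ∸ c) (s≤s (m∸n≤m n c)) vanish ⟩
    f (n ∸ c) ℤ.* zpow c (n ∸ (n ∸ c))    ≡⟨ cong (λ e → f (n ∸ c) ℤ.* zpow c e) (m∸[m∸n]≡n c≤n) ⟩
    f (n ∸ c) ℤ.* zpow c c                ≡⟨ cong (f (n ∸ c) ℤ.*_) (zpow-diag c) ⟩
    f (n ∸ c) ℤ.* + 1                     ≡⟨ ℤₚ.*-identityʳ (f (n ∸ c)) ⟩
    f (n ∸ c)                             ≡⟨ sym (shift-∸ c f c≤n) ⟩
    shift c f n                           ∎
  where
  open ≡-Reasoning
  vanish : ∀ j → j < suc n → j ≢ n ∸ c → f j ℤ.* zpow c (n ∸ j) ≡ + 0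
  vanish j j≤n j≢ = trans (cong (f j ℤ.*_) (zpow-offdiag c (n ∸ j) c≢))
                          (ℤₚ.*-zeroʳ (f j))
    where
    c≢ : c ≢ n ∸ j
    c≢ c≡ = j≢ (trans (sym (m∸[m∸n]≡n (s≤s⁻¹ j≤n))) (cong (n ∸_) (sym c≡)))
... | inj₂ n<c = trans (sumBelow-zero (suc n) vanish) (sym (shift-below c f n<c))
  where
  vanish : ∀ j → j < suc n → f j ℤ.* zpow c (n ∸ j) ≡ + 0
  vanish j _ = trans (cong (f j ℤ.*_)
                           (zpow-offdiag c (n ∸ j) (λ c≡ → <-irrefl (sym c≡) (≤-<-trans (m∸n≤m n j) n<c))))
                     (ℤₚ.*-zeroʳ (f j))

even : ℕ → Bool
even zero          = true
even (suc zero)    = false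
even (suc (suc n)) = even n

ind : Bool → ℤ
ind b = if b then + 1 else + 0

even-% : ∀ n → ((n % 2) ≡ᵇ 0) ≡ even n
even-% zero          = refl
even-% (suc zero)    = refl
even-% (suc (suc n)) = trans (cong (λ m → (m % 2) ≡ᵇ 0) (+-comm 2 n))
                             (trans (cong (_≡ᵇ 0) ([m+kn]%n≡m%n n 1 2)) (even-% n))

even-suc : ∀ n → even (suc n) ≡ not (even n)
even-suc zero          = refl
even-suc (suc zero)    = refl
even-suc (suc (suc n)) = even-suc n

even-2*+ : ∀ q x → even (2 * q + x) ≡ even x
even-2*+ zero    x = refl
even-2*+ (suc q) x rewrite +-suc q (q + 0) = even-2*+ q x

inv1-z²-even : ∀ n → inv1-z² n ≡ ind (even n)
inv1-z²-even n = cong ind (even-% n)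

geomPrefix : ℕ → Series
geomPrefix b = inv1-z² -ₛ shift b inv1-z²

geomPrefix-below : ∀ b x → x < b → geomPrefix b x ≡ ind (even x)
geomPrefix-below b x x<b = begin
  inv1-z² x ℤ.- shift b inv1-z² x  ≡⟨ cong (ℤ._-_ (inv1-z² x)) (shift-below b inv1-z² x<b) ⟩
  inv1-z² x ℤ.+ + 0                ≡⟨ ℤₚ.+-identityʳ (inv1-z² x) ⟩
  inv1-z² x                        ≡⟨ inv1-z²-even x ⟩
  ind (even x)                     ∎
  where open ≡-Reasoning

geomPrefix-above : ∀ q x → 2 * q ≤ suc x → geomPrefix (2 * q) x ≡ + 0
geomPrefix-above q x 2q≤1+x with m≤n⇒m<n∨m≡n 2q≤1+x
... | inj₁ 2q≤x = begin
    inv1-z² x ℤ.- shift (2 * q) inv1-z² x  ≡⟨ cong (ℤ._-_ (inv1-z² x)) (shift-∸ (2 * q) inv1-z² (s≤s⁻¹ 2q≤x)) ⟩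
    inv1-z² x ℤ.- inv1-z² y                ≡⟨ cong (λ e → ind e ℤ.- inv1-z² y) same-parity ⟩
    inv1-z² y ℤ.- inv1-z² y                ≡⟨ ℤₚ.+-inverseʳ (inv1-z² y) ⟩
    + 0                                    ∎
  where
  open ≡-Reasoning
  y = x ∸ 2 * q
  same-parity : ((x % 2) ≡ᵇ 0) ≡ ((y % 2) ≡ᵇ 0)
  same-parity = begin
    (x % 2) ≡ᵇ 0  ≡⟨ even-% x ⟩
    even x        ≡⟨ cong even (sym (m+[n∸m]≡n (s≤s⁻¹ 2q≤x))) ⟩
    even (2 * q + y) ≡⟨ even-2*+ q y ⟩
    even y        ≡⟨ sym (even-% y) ⟩
    (y % 2) ≡ᵇ 0  ∎
... | inj₂ 2q≡1+x = begin
    geomPrefix (2 * q) x  ≡⟨ geomPrefix-below (2 * q) x (subst (x <_) (sym 2q≡1+x) ≤-refl) ⟩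
    ind (even x)          ≡⟨ cong ind x-odd ⟩
    + 0                   ∎
  where
  open ≡-Reasoning
  x-odd : even x ≡ false
  x-odd = begin
    even x                  ≡⟨ sym (not-involutive (even x)) ⟩
    not (not (even x))      ≡⟨ cong not (sym (even-suc x)) ⟩
    not (even (suc x))      ≡⟨ cong (λ m → not (even m)) (sym 2q≡1+x) ⟩
    not (even (2 * q))      ≡⟨ cong (λ m → not (even m)) (sym (+-identityʳ (2 * q))) ⟩
    not (even (2 * q + 0))  ≡⟨ cong not (even-2*+ q 0) ⟩
    false                   ∎

z²/[1-z²] : Series
z²/[1-z²] = zpow 2 *ₛ inv1-z²

zpow-*ₛ-binomial : ∀ a b m → (zpow a *ₛ (zpow 0 -ₛ zpow b)) m ≡ (zpow a -ₛ zpow (a + b)) m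
zpow-*ₛ-binomial a b m = begin
  (zpow a *ₛ (zpow 0 -ₛ zpow b)) m                   ≡⟨ zpow-*ₛ a (zpow 0 -ₛ zpow b) m ⟩
  shift a (zpow 0 -ₛ zpow b) m                       ≡⟨ shift-- a (zpow 0) (zpow b) m ⟩
  shift a (zpow 0) m ℤ.- shift a (zpow b) m          ≡⟨ cong₂ ℤ._-_ (sym (zpow-shift a m)) lower ⟩
  zpow a m ℤ.- zpow (a + b) m                        ∎
  where
  open ≡-Reasoning
  lower : shift a (zpow b) m ≡ zpow (a + b) m
  lower = trans (shift-cong a (zpow-shift b) m)
                (trans (shift-shift a b (zpow 0) m) (sym (zpow-shift (a + b) m)))

summand-shape : ∀ a b n →
  (z²/[1-z²] *ₛ (zpow a *ₛ (zpow 0 -ₛ zpow b))) n ≡ shift (a + 2) (geomPrefix b) n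
summand-shape a b n = begin
  (z²/[1-z²] *ₛ (zpow a *ₛ (zpow 0 -ₛ zpow b))) n
    ≡⟨ *ₛ-congʳ z²/[1-z²] (zpow-*ₛ-binomial a b) n ⟩
  (z²/[1-z²] *ₛ (zpow a -ₛ zpow (a + b))) n
    ≡⟨ *ₛ-distribˡ-- z²/[1-z²] (zpow a) (zpow (a + b)) n ⟩
  (z²/[1-z²] *ₛ zpow a) n ℤ.- (z²/[1-z²] *ₛ zpow (a + b)) n
    ≡⟨ cong₂ ℤ._-_ (*ₛ-zpow z²/[1-z²] a n) (*ₛ-zpow z²/[1-z²] (a + b) n) ⟩
  shift a z²/[1-z²] n ℤ.- shift (a + b) z²/[1-z²] n
    ≡⟨ cong₂ ℤ._-_ (shift-z² a) (shift-z² (a + b)) ⟩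
  shift (a + 2) inv1-z² n ℤ.- shift (a + b + 2) inv1-z² n
    ≡⟨ cong (λ c → shift (a + 2) inv1-z² n ℤ.- shift c inv1-z² n) (+-assoc-comm a b 2) ⟩
  shift (a + 2) inv1-z² n ℤ.- shift (a + 2 + b) inv1-z² n
    ≡⟨ cong (ℤ._-_ (shift (a + 2) inv1-z² n)) (sym (shift-shift (a + 2) b inv1-z² n)) ⟩
  shift (a + 2) inv1-z² n ℤ.- shift (a + 2) (shift b inv1-z²) n
    ≡⟨ sym (shift-- (a + 2) inv1-z² (shift b inv1-z²) n) ⟩
  shift (a + 2) (geomPrefix b) n  ∎
  where
  open ≡-Reasoning
  shift-z² : ∀ c → shift c z²/[1-z²] n ≡ shift (c + 2) inv1-z² n
  shift-z² c = trans (shift-cong c (zpow-*ₛ 2 inv1-z²) n) (shift-shift c 2 inv1-z² n)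
  +-assoc-comm : ∀ a b c → a + b + c ≡ a + c + b
  +-assoc-comm = ℕ-Solver.solve-∀

blockStart : ℕ → ℕ → ℕ
blockStart s k = s * k + 2 ^ suc k

childStart : ℕ → ℕ → ℕ
childStart s k = blockStart s k + s

blockStart-suc : ∀ s k → blockStart s (suc k) ≡ childStart s k + 2 ^ suc k
blockStart-suc s k = rearrange s k (2 ^ suc k)
  where
  rearrange : ∀ s k p → s * suc k + 2 * p ≡ s * k + p + s + p
  rearrange = ℕ-Solver.solve-∀

blockStart-mono : ∀ s {k t} → k ≤′ t → blockStart s k ≤ blockStart s t
blockStart-mono s ≤′-refl = ≤-refl
blockStart-mono s {t = suc t} (≤′-step k≤t) =
  ≤-trans (blockStart-mono s k≤t)
          (subst (blockStart s t ≤_) (sym (blockStart-suc s t))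
                 (≤-trans (m≤m+n (blockStart s t) s) (m≤m+n (childStart s t) (2 ^ suc t))))

n<2^n : ∀ n → n < 2 ^ n
n<2^n zero    = s≤s z≤n
n<2^n (suc n) = +-mono-≤ (m^n>0 2 n) (≤-trans (n<2^n n) (m≤m+n (2 ^ n) 0))

2^≤blockStart : ∀ s k → 2 ^ suc k ≤ blockStart s k
2^≤blockStart s k = m≤n+m (2 ^ suc k) (s * k)

childStart-positive : ∀ s k → 1 ≤ childStart s k
childStart-positive s k =
  ≤-trans (m^n>0 2 (suc k)) (≤-trans (2^≤blockStart s k) (m≤m+n (blockStart s k) s))

exponent+2 : ∀ s k → s * suc k + 2 ^ suc k ∸ 1 + 2 ≡ suc (childStart s k)
exponent+2 s k = begin
  s * suc k + 2 ^ suc k ∸ 1 + 2   ≡⟨ cong (λ c → c ∸ 1 + 2) (childStart≡ s k (2 ^ suc k)) ⟩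
  c ∸ 1 + 2                       ≡⟨ +-suc (c ∸ 1) 1 ⟩
  suc (c ∸ 1 + 1)                 ≡⟨ cong suc (m∸n+n≡m (childStart-positive s k)) ⟩
  suc c                           ∎
  where
  open ≡-Reasoning
  c = childStart s k
  childStart≡ : ∀ s k p → s * suc k + p ≡ s * k + p + s
  childStart≡ = ℕ-Solver.solve-∀

summand : ℕ → ℕ → Series
summand s k = z²/[1-z²] *ₛ term s (suc k)

summand-shift : ∀ s k n → summand s k n ≡ shift (suc (childStart s k)) (geomPrefix (2 ^ suc k)) n
summand-shift s k n =
  trans (summand-shape (s * suc k + 2 ^ suc k ∸ 1) (2 ^ suc k) n)
        (cong (λ c → shift c (geomPrefix (2 ^ suc k)) n) (exponent+2 s k))

summand-below : ∀ s k {n} → n ≤ childStart s k → summand s k n ≡ + 0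
summand-below s k {n} n≤c =
  trans (summand-shift s k n) (shift-below (suc (childStart s k)) _ (s≤s n≤c))

summand-above : ∀ s k {n} → childStart s k + 2 ^ suc k ≤ n → summand s k n ≡ + 0
summand-above s k {n} end≤n = begin
  summand s k n                         ≡⟨ summand-shift s k n ⟩
  shift (suc c) (geomPrefix b) n        ≡⟨ shift-∸ (suc c) (geomPrefix b) c<n ⟩
  geomPrefix b (n ∸ suc c)              ≡⟨ geomPrefix-above (2 ^ k) (n ∸ suc c) b≤ ⟩
  + 0                                   ∎
  where
  open ≡-Reasoning
  c = childStart s k
  b = 2 ^ suc k
  c<n : suc c ≤ n
  c<n = ≤-trans (≤-reflexive (+-comm 1 c)) (≤-trans (+-monoʳ-≤ c (m^n>0 2 (suc k))) end≤n)
  b≤ : b ≤ suc (n ∸ suc c)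
  b≤ = subst (b ≤_) (+-∸-assoc 1 c<n)
         (≤-trans (≤-reflexive (sym (m+n∸m≡n c b))) (∸-monoˡ-≤ c end≤n))

summand-children : ∀ s k y → y < 2 ^ suc k →
                   summand s k (childStart s k + y) ≡ ind (not (even y))
summand-children s k zero    _     = summand-below s k (≤-reflexive (+-identityʳ (childStart s k)))
summand-children s k (suc x) 1+x<b = begin
  summand s k (c + suc x)                     ≡⟨ summand-shift s k (c + suc x) ⟩
  shift (suc c) (geomPrefix b) (c + suc x)    ≡⟨ cong (shift (suc c) (geomPrefix b)) (+-suc c x) ⟩
  shift (suc c) (geomPrefix b) (suc c + x)    ≡⟨ shift-+ (suc c) (geomPrefix b) x ⟩
  geomPrefix b x                              ≡⟨ geomPrefix-below b x (<-trans (n<1+n x) 1+x<b) ⟩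
  ind (even x)                                ≡⟨ cong ind (sym (not-involutive (even x))) ⟩
  ind (not (not (even x)))                    ≡⟨ cong (λ e → ind (not e)) (sym (even-suc x)) ⟩
  ind (not (even (suc x)))                    ∎
  where
  open ≡-Reasoning
  c = childStart s k
  b = 2 ^ suc k

leafOffset : ℕ → ℕ → Bool
leafOffset s o = if o <ᵇ s then false else not (((o ∸ s) % 2) ≡ᵇ 0)

summand-block : ∀ s k o → o < s + 2 ^ suc k →
                summand s k (blockStart s k + o) ≡ ind (leafOffset s o)
summand-block s k o o<size with o <ᵇ s | <ᵇ-reflects-< o s
... | true  | ofʸ o<s = summand-below s k (+-monoʳ-≤ (blockStart s k) (<⇒≤ o<s))
... | false | ofⁿ o≮s = begin
  summand s k (blockStart s k + o)        ≡⟨ cong (summand s k) start≡ ⟩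
  summand s k (childStart s k + y)        ≡⟨ summand-children s k y y<b ⟩
  ind (not (even y))                      ≡⟨ cong (λ e → ind (not e)) (sym (even-% y)) ⟩
  ind (not ((y % 2) ≡ᵇ 0))                ∎
  where
  open ≡-Reasoning
  s≤o = ≮⇒≥ o≮s
  y = o ∸ s
  start≡ : blockStart s k + o ≡ childStart s k + y
  start≡ = trans (cong (_+_ (blockStart s k)) (sym (m+[n∸m]≡n s≤o))) (sym (+-assoc (blockStart s k) s y))
  y<b : y < 2 ^ suc k
  y<b = subst (y <_) (m+n∸m≡n s (2 ^ suc k)) (∸-monoˡ-< o<size s≤o)

summand-other : ∀ s k t o → o < s + 2 ^ suc t → k ≢ t →
                summand s k (blockStart s t + o) ≡ + 0
summand-other s k t o o<size k≢t with <-cmp k t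
... | tri< k<t _ _ = summand-above s k
      (≤-trans (≤-reflexive (sym (blockStart-suc s k)))
               (≤-trans (blockStart-mono s (≤⇒≤′ k<t)) (m≤m+n (blockStart s t) o)))
... | tri≈ _ k≡t _ = ⊥-elim (k≢t k≡t)
... | tri> _ _ t<k = summand-below s k
      (≤-trans (<⇒≤ n<next)
               (≤-trans (blockStart-mono s (≤⇒≤′ t<k)) (m≤m+n (blockStart s k) s)))
  where
  n<next : blockStart s t + o < blockStart s (suc t)
  n<next = subst (blockStart s t + o <_)
                 (sym (trans (blockStart-suc s t) (+-assoc (blockStart s t) s (2 ^ suc t))))
                 (+-monoʳ-< (blockStart s t) o<size)

record Decoded (s n : ℕ) (leaf : Bool) : Set where
  constructor decoded
  field
    block offset : ℕ
    label≡       : n ≡ blockStart s block + offset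
    offset<      : offset < s + 2 ^ suc block
    leaf≡        : leaf ≡ leafOffset s offset

relabel : ∀ {s n n' leaf} → n ≡ n' → Decoded s n leaf → Decoded s n' leaf
relabel refl d = d

leafOffset-unfold : ∀ s o {b} → (o <ᵇ s) ≡ b →
                    leafOffset s o ≡ (if b then false else not (((o ∸ s) % 2) ≡ᵇ 0))
leafOffset-unfold s o refl = refl

isLeaf-childOrLeaf : ∀ c i x y → isLeaf (if c then child i x else leaf i y) ≡ not c
isLeaf-childOrLeaf true  i x y = refl
isLeaf-childOrLeaf false i x y = refl

locate-decodes : ∀ s fuel k m → m ≤ fuel →
                 Decoded s (blockStart s k + m) (isLeaf (locate s fuel (suc k) m))
locate-decodes s fuel k m m≤fuel with m <ᵇ s in m<ᵇs | <ᵇ-reflects-< m s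
... | true  | ofʸ m<s =
  decoded k m refl (<-≤-trans m<s (m≤m+n s _)) (sym (leafOffset-unfold s m m<ᵇs))
... | false | ofⁿ m≮s with (m ∸ s) <ᵇ 2 ^ suc k | <ᵇ-reflects-< (m ∸ s) (2 ^ suc k)
...   | true  | ofʸ y<b = decoded k m refl m<size
  (trans (isLeaf-childOrLeaf _ (suc k) _ _) (sym (leafOffset-unfold s m m<ᵇs)))
  where
  m<size : m < s + 2 ^ suc k
  m<size = subst (_< s + 2 ^ suc k) (m+[n∸m]≡n (≮⇒≥ m≮s)) (+-monoʳ-< s y<b)
locate-decodes s zero k m m≤0 | false | ofⁿ _ | false | ofⁿ y≮b =
  ⊥-elim (y≮b (≤-<-trans (≤-trans (m∸n≤m m s) m≤0) (m^n>0 2 (suc k))))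
locate-decodes s (suc fuel) k m m≤1+fuel | false | ofⁿ m≮s | false | ofⁿ y≮b =
  relabel (sym next≡) (locate-decodes s fuel (suc k) (m ∸ size) rest≤fuel)
  where
  size = s + 2 ^ suc k
  size≤m : size ≤ m
  size≤m = subst (size ≤_) (m+[n∸m]≡n (≮⇒≥ m≮s)) (+-monoʳ-≤ s (≮⇒≥ y≮b))
  rest≤fuel : m ∸ size ≤ fuel
  rest≤fuel = ≤-trans (∸-monoʳ-≤ m (≤-trans (m^n>0 2 (suc k)) (m≤n+m _ s))) (∸-monoˡ-≤ 1 m≤1+fuel)
  next≡ : blockStart s k + m ≡ blockStart s (suc k) + (m ∸ size)
  next≡ = begin
    blockStart s k + m                     ≡⟨ cong (_+_ (blockStart s k)) (sym (m+[n∸m]≡n size≤m)) ⟩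
    blockStart s k + (size + (m ∸ size))   ≡⟨ sym (+-assoc (blockStart s k) size (m ∸ size)) ⟩
    blockStart s k + size + (m ∸ size)     ≡⟨ cong (_+ (m ∸ size)) (sym blockStart-next) ⟩
    blockStart s (suc k) + (m ∸ size)      ∎
    where
    open ≡-Reasoning
    blockStart-next : blockStart s (suc k) ≡ blockStart s k + size
    blockStart-next = trans (blockStart-suc s k) (+-assoc (blockStart s k) s (2 ^ suc k))

v-decodes : ∀ s m → Decoded s (suc (suc m)) (isLeaf (v s (suc (suc m))))
v-decodes s m = relabel start≡ (locate-decodes s m 0 m ≤-refl)
  where
  start≡ : blockStart s 0 + m ≡ suc (suc m)
  start≡ = cong (λ x → x + 2 + m) (*-zeroʳ s)

coefficient : ∀ s N n → n ≤ N →
              lhs s n ≡ zpow 1 n ℤ.+ sumSeries (λ i → z²/[1-z²] *ₛ term s i) N n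
coefficient s N zero _ =
  sym (trans (ℤₚ.+-identityˡ _) (sumSeries-zero _ N 0 (λ k _ → summand-below s k z≤n)))
coefficient s N (suc zero) _ =
  sym (cong (ℤ._+_ (+ 1)) (sumSeries-zero _ N 1 (λ k _ → summand-below s k (childStart-positive s k))))
coefficient s N (suc (suc m)) n≤N with v-decodes s m
... | decoded t o label≡ o<size leaf≡ = begin
  ind (isLeaf (v s n))                                   ≡⟨ cong ind leaf≡ ⟩
  ind (leafOffset s o)                                   ≡⟨ sym (summand-block s t o o<size) ⟩
  summand s t (blockStart s t + o)                       ≡⟨ cong (summand s t) (sym label≡) ⟩
  summand s t n                                          ≡⟨ sym (sumSeries-single _ N n t t<N others) ⟩
  sumSeries (λ i → z²/[1-z²] *ₛ term s i) N n            ≡⟨ sym (ℤₚ.+-identityˡ _) ⟩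
  zpow 1 n ℤ.+ sumSeries (λ i → z²/[1-z²] *ₛ term s i) N n  ∎
  where
  open ≡-Reasoning
  n = suc (suc m)
  t<N : suc t ≤ N
  t<N = ≤-trans (<⇒≤ (n<2^n (suc t)))
          (≤-trans (2^≤blockStart s t)
            (≤-trans (m≤m+n (blockStart s t) o) (subst (_≤ N) label≡ n≤N)))
  others : ∀ k → suc k ≤ N → k ≢ t → summand s k n ≡ + 0
  others k _ k≢t = trans (cong (summand s k) label≡) (summand-other s k t o o<size k≢t)

theorem3p2 : (s N n : ℕ) → n ≤ N → lhs s n ≡ rhsUpTo s N n
theorem3p2 s N n n≤N = begin
  lhs s n                                                    ≡⟨ coefficient s N n n≤N ⟩
  zpow 1 n ℤ.+ sumSeries (λ i → z²/[1-z²] *ₛ term s i) N n   ≡⟨ cong (ℤ._+_ (zpow 1 n)) (sym (*ₛ-distribˡ-sumSeries z²/[1-z²] (term s) N n)) ⟩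
  rhsUpTo s N n                                              ∎
  where open ≡-Reasoning
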